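{- Let $D_1$ be a tournament with $\mathrm{inv}(D_1)=\mathrm{tmr}(D_1)+1$, and let $D_2$ be any oriented graph with $\mathrm{inv}(D_2)\ge 1$. Then $\mathrm{inv}(D_1\rightarrow D_2)\le \mathrm{inv}(D_1)+\mathrm{inv}(D_2)-1$.
   Context: An oriented graph is a simple directed graph with no loops and at most one of $uv$, $vu$ per pair; a tournament has exactly one per pair, and is transitive if acyclic. For $X\subseteq V(D)$, inverting $X$ reverses every edge with both endpoints in $X$; $\mathrm{inv}(D)$ is the minimum number of sets whose successive inversion yields an acyclic oriented graph. The dijoin $D_1\rightarrow D_2$ consists of vertex-disjoint copies of $D_1$, $D_2$ plus all edges $uv$ with $u\in V(D_1)$, $v\in V(D_2)$. Ranks are over $\mathbb{F}_2$. For an undirected graph $G$ on $n$ vertices, $\mathcal{M}(G)$ is the set of $n\times n$ $\{0,1\}$-matrices obtained from the adjacency matrix of $G$ by arbitrarily altering diagonal entries. For a tournament $D$ on vertex set $V$ and a transitive tournament $T$ on $V$, $G_{D,T}$ is the undirected graph on $V$ with $ij$ an edge iff the edge between $i,j$ is oriented differently in $D$ and $T$; $\mathcal{M}^*(D)=\bigcup_T\mathcal{M}(G_{D,T})$ over all transitive tournaments $T$ on $V$, and $\mathrm{tmr}(D)=\min\{\mathrm{rank}(M):M\in\mathcal{M}^*(D)\}$. -}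

module Defs where

open import Data.Nat using (ℕ; zero; suc; _+_; _≤_)
open import Data.Bool using (Bool; true; false; _∧_; _xor_; if_then_else_)
open import Data.Fin using (Fin; zero; suc; inject₁; fromℕ; splitAt)
open import Data.Sum using (_⊎_; inj₁; inj₂)
open import Data.List using (List; []; _∷_; length)
open import Data.Product using (Σ; ∃; _×_; _,_)
open import Relation.Binary.PropositionalEquality using (_≡_; _≢_)
open import Relation.Nullary using (¬_)

-- Digraphs on vertex set Fin n, given by the adjacency function:
-- D i j ≡ true  iff  ij (from i to j) is an edge.

Digraph : ℕ → Set
Digraph n = Fin n → Fin n → Bool

IsOriented : ∀ {n} → Digraph n → Set
IsOriented D = (∀ i → D i i ≡ false) × (∀ i j → D i j ≡ true → D j i ≡ false)

IsTournament : ∀ {n} → Digraph n → Set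
IsTournament D = IsOriented D × (∀ i j → i ≢ j → (D i j ≡ true) ⊎ (D j i ≡ true))

-- A directed cycle (closed directed walk) v₀ → v₁ → … → v_k → v₀.
Cycle : ∀ {n} → Digraph n → Set
Cycle {n} D =
  Σ ℕ λ k → Σ (Fin (suc k) → Fin n) λ v →
    (∀ (i : Fin k) → D (v (inject₁ i)) (v (suc i)) ≡ true) ×
    (D (v (fromℕ k)) (v zero) ≡ true)

Acyclic : ∀ {n} → Digraph n → Set
Acyclic D = ¬ Cycle D

-- Transitive tournament = acyclic tournament.
IsTransitiveTournament : ∀ {n} → Digraph n → Set
IsTransitiveTournament D = IsTournament D × Acyclic D

Subset : ℕ → Set
Subset n = Fin n → Bool

invert : ∀ {n} → Subset n → Digraph n → Digraph n
invert X D i j = if X i ∧ X j then D j i else D i j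

invertAll : ∀ {n} → List (Subset n) → Digraph n → Digraph n
invertAll []       D = D
invertAll (X ∷ Xs) D = invertAll Xs (invert X D)

InvAtMost : ∀ {n} → Digraph n → ℕ → Set
InvAtMost {n} D m =
  Σ (List (Subset n)) λ Xs → (length Xs ≤ m) × Acyclic (invertAll Xs D)

IsInv : ∀ {n} → Digraph n → ℕ → Set
IsInv D k = InvAtMost D k × (∀ j → InvAtMost D j → k ≤ j)

dijoin : ∀ {n₁ n₂} → Digraph n₁ → Digraph n₂ → Digraph (n₁ + n₂)
dijoin {n₁} D₁ D₂ x y with splitAt n₁ x | splitAt n₁ y
... | inj₁ a | inj₁ b = D₁ a b
... | inj₂ a | inj₂ b = D₂ a b
... | inj₁ _ | inj₂ _ = true
... | inj₂ _ | inj₁ _ = false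

-- Rank over F₂ (Bool with xor as addition).
-- An n × n matrix is M : Fin n → Fin n → Bool (M i = i-th row).

Matrix : ℕ → Set
Matrix n = Fin n → Fin n → Bool

sumRows : ∀ {m c} → (Fin m → Fin c → Bool) → (Fin m → Bool) → Fin c → Bool
sumRows {zero}  M S j = false
sumRows {suc m} M S j =
  (if S zero then M zero j else false) xor sumRows (λ i → M (suc i)) (λ i → S (suc i)) j

count : ∀ {m} → (Fin m → Bool) → ℕ
count {zero}  S = 0
count {suc m} S = (if S zero then 1 else 0) + count (λ i → S (suc i))

RowsIndependent : ∀ {n} → Matrix n → (Fin n → Bool) → Set
RowsIndependent {n} M S =
  ∀ (T : Fin n → Bool) →
    (∀ i → T i ≡ true → S i ≡ true) →
    (Σ (Fin n) λ i → T i ≡ true) →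
    ¬ (∀ j → sumRows M T j ≡ false)

HasRank : ∀ {n} → Matrix n → ℕ → Set
HasRank {n} M r =
  (Σ (Fin n → Bool) λ S → RowsIndependent M S × count S ≡ r) ×
  (∀ S → RowsIndependent M S → count S ≤ r)

-- G_{D,T} (as an undirected adjacency function): ij is an edge iff the
-- edge between i and j is oriented differently in D and T.
-- For tournaments D, T and i ≠ j this is exactly D i j ≠ T i j.
GDT : ∀ {n} → Digraph n → Digraph n → Fin n → Fin n → Bool
GDT D T i j = D i j xor T i j

InM : ∀ {n} → (Fin n → Fin n → Bool) → Matrix n → Set
InM G M = ∀ i j → i ≢ j → M i j ≡ G i j

InMStar : ∀ {n} → Digraph n → Matrix n → Set
InMStar {n} D M = Σ (Digraph n) λ T → IsTransitiveTournament T × InM (GDT D T) M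

IsTmr : ∀ {n} → Digraph n → ℕ → Set
IsTmr {n} D t =
  (Σ (Matrix n) λ M → InMStar D M × HasRank M t) ×
  (∀ M r → InMStar D M → HasRank M r → t ≤ r)

-- Let M ∈ 𝓜*(D₁) have rank t, witnessed by the transitive tournament T.  Over F₂ a
-- symmetric matrix of rank t is a sum of at most t + 1 terms x xᵀ whose vectors carry
-- an extra coordinate f with Σ f x = 0 and Σ f² = 1: peel off x xᵀ at a nonzero
-- diagonal entry, or a hyperbolic pair x yᵀ + y xᵀ at a nonzero off-diagonal entry,
-- which lowers the rank by one or two.  Given sets Y₁, …, Y_k making D₂ acyclic,
-- invert in D₁ → D₂ the set x ∪ (Y₁ if f = 1) for every term, and then Y₂, …, Y_k.
-- An edge is reversed iff it lies in an odd number of these sets.  Inside D₁ that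
-- parity is M, so D₁ turns into T; between the parts it is Y₁(b) Σ f x(a) = 0, so the
-- arcs of the dijoin stay; inside D₂ it is that of Y₁, …, Y_k because Σ f² = 1.  The
-- result is T → D₂', which is acyclic, obtained with t + 1 + k − 1 inversions.

module Submission where

open import Defs
open import Data.Bool using (Bool; true; false; not; _∧_; _xor_; if_then_else_)
open import Data.Bool.Properties as Boolₚ
  using ( xor-∧-commutativeRing; ∧-comm; ∧-zeroʳ; ∧-identityʳ; ∧-distribˡ-xor
        ; xor-assoc; xor-comm; xor-identityʳ; xor-same; xor-annihilates-not; if-eta; if-not; if-cong; ¬-not)
open import Data.Fin using (Fin; zero; suc; inject₁; fromℕ; splitAt; _≟_)
open import Data.Fin.Properties using (any?; all?)
open import Data.List using (List; []; _∷_; length; map; _++_)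
open import Data.List.Properties using (length-map; length-++)
open import Data.Maybe using (Maybe; just; nothing)
open import Data.Nat using (ℕ; zero; suc; _+_; _∸_; _≤_; _<_; z≤n; s≤s)
open import Data.Nat.Induction using (<-rec)
open import Data.Nat.Properties using (≤-refl; ≤-trans; ≤-reflexive; <⇒≤; +-suc; +-comm; +-mono-≤; 1+n≰n)
open import Data.Product using (∃-syntax; ∃₂; _×_; _,_; proj₁)
open import Data.Sum using (_⊎_; inj₁; inj₂; [_,_]′)
open import Data.Vec.Functional using (updateAt)
open import Data.Vec.Functional.Properties using (updateAt-updates; updateAt-minimal)
open import Function using (_∘_; const)
open import Level using (0ℓ)
open import Relation.Binary.PropositionalEquality
open import Relation.Nullary using (¬_; Dec; yes; no; contradiction)
open import Tactic.RingSolver using (solve-∀)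
open import Tactic.RingSolver.Core.AlmostCommutativeRing using (AlmostCommutativeRing; fromCommutativeRing)

private
  variable
    A B : Set
    m n n₁ n₂ : ℕ

-- The solver computes with coefficients in Bool itself, so it also knows 1 + 1 = 0.
F₂ : AlmostCommutativeRing 0ℓ 0ℓ
F₂ = fromCommutativeRing xor-∧-commutativeRing isFalse
  where
  isFalse : ∀ b → Maybe (false ≡ b)
  isFalse false = just refl
  isFalse true  = nothing

_≗₂_ : (f g : A → A → B) → Set
f ≗₂ g = ∀ x y → f x y ≡ g x y

xorSum : List A → (A → Bool) → Bool
xorSum []       h = false
xorSum (a ∷ as) h = h a xor xorSum as h

xorSum-cong : ∀ (as : List A) {h h′ : A → Bool} → (∀ a → h a ≡ h′ a) → xorSum as h ≡ xorSum as h′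
xorSum-cong []       eq = refl
xorSum-cong (a ∷ as) eq = cong₂ _xor_ (eq a) (xorSum-cong as eq)

xorSum-false : ∀ (as : List A) → xorSum as (const false) ≡ false
xorSum-false []       = refl
xorSum-false (a ∷ as) = xorSum-false as

xorSum-∧ : ∀ (as : List A) c (h : A → Bool) → xorSum as (λ a → c ∧ h a) ≡ c ∧ xorSum as h
xorSum-∧ []       c h = sym (∧-zeroʳ c)
xorSum-∧ (a ∷ as) c h = trans (cong ((c ∧ h a) xor_) (xorSum-∧ as c h)) (sym (∧-distribˡ-xor c (h a) _))

xorSum-++ : ∀ (as bs : List A) h → xorSum (as ++ bs) h ≡ xorSum as h xor xorSum bs h
xorSum-++ []       bs h = refl
xorSum-++ (a ∷ as) bs h = trans (cong (h a xor_) (xorSum-++ as bs h)) (sym (xor-assoc (h a) _ _))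

xorSum-map : ∀ (g : A → B) as h → xorSum (map g as) h ≡ xorSum as (h ∘ g)
xorSum-map g []       h = refl
xorSum-map g (a ∷ as) h = cong (h (g a) xor_) (xorSum-map g as h)

-- Inversions act through parities

parity : List (A → Bool) → A → A → Bool
parity Xs x y = xorSum Xs (λ X → X x ∧ X y)

parity-comm : ∀ (Xs : List (A → Bool)) x y → parity Xs x y ≡ parity Xs y x
parity-comm Xs x y = xorSum-cong Xs (λ X → ∧-comm (X x) (X y))

parity-∘ : ∀ (g : A → B) Xs x y → parity (map (_∘ g) Xs) x y ≡ parity Xs (g x) (g y)
parity-∘ g Xs x y = xorSum-map (_∘ g) Xs _

reverseWhere : (Fin n → Fin n → Bool) → Digraph n → Digraph n
reverseWhere N D x y = if N x y then D y x else D x y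

reverseWhere-cong : ∀ {N N′ : Fin n → Fin n → Bool} (D : Digraph n) →
  N ≗₂ N′ → reverseWhere N D ≗₂ reverseWhere N′ D
reverseWhere-cong D eq x y = if-cong (eq x y)

invertAll-parity : ∀ (Xs : List (Subset n)) D → invertAll Xs D ≗₂ reverseWhere (parity Xs) D
invertAll-parity []       D x y = refl
invertAll-parity (X ∷ Xs) D x y
  rewrite invertAll-parity Xs (invert X D) x y | ∧-comm (X y) (X x)
  with X x ∧ X y
... | false = refl
... | true  = sym (if-not (parity Xs x y))

Acyclic-resp : ∀ {D E : Digraph n} → D ≗₂ E → Acyclic D → Acyclic E
Acyclic-resp D≗E acyclic (k , v , walk , closing) =
  acyclic (k , v , (λ i → trans (D≗E _ _) (walk i)) , trans (D≗E _ _) closing)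

IsWalk : ∀ {k} → Digraph n → (Fin (suc k) → Fin n) → Set
IsWalk {k = k} D v = ∀ (i : Fin k) → D (v (inject₁ i)) (v (suc i)) ≡ true

module _ {D : Digraph n} (P : Fin n → Set) where

  walk-forward : (∀ {x y} → D x y ≡ true → P x → P y) →
                 ∀ {k} (v : Fin (suc k) → Fin n) → IsWalk D v → P (v zero) → ∀ i → P (v i)
  walk-forward step v walk p zero = p
  walk-forward step {suc k} v walk p (suc i) =
    walk-forward step (v ∘ suc) (walk ∘ suc) (step (walk zero) p) i

  walk-backward : (∀ {x y} → D x y ≡ true → P y → P x) →
                  ∀ {k} (v : Fin (suc k) → Fin n) → IsWalk D v → P (v (fromℕ k)) → ∀ i → P (v i)
  walk-backward step {zero}  v walk p zero    = p
  walk-backward step {suc k} v walk p zero    =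
    step (walk zero) (walk-backward step (v ∘ suc) (walk ∘ suc) p zero)
  walk-backward step {suc k} v walk p (suc i) = walk-backward step (v ∘ suc) (walk ∘ suc) p i

restrict-cycle : ∀ {E : Digraph m} {D : Digraph n} (P : Fin m → Set) (π : ∀ {x} → P x → Fin n) →
  (∀ {x y} (p : P x) (q : P y) → E x y ≡ true → D (π p) (π q) ≡ true) →
  ∀ k (v : Fin (suc k) → Fin m) → IsWalk E v → E (v (fromℕ k)) (v zero) ≡ true →
  (∀ i → P (v i)) → Cycle D
restrict-cycle P π edge k v walk closing inP =
  k , (λ i → π (inP i)) , (λ i → edge (inP _) (inP _) (walk i)) , edge (inP _) (inP _) closing

module _ {D₁ : Digraph n₁} {D₂ : Digraph n₂} where

  OnLeft OnRight : Fin (n₁ + n₂) → Set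
  OnLeft  x = ∃[ a ] splitAt n₁ x ≡ inj₁ a
  OnRight x = ∃[ b ] splitAt n₁ x ≡ inj₂ b

  dijoin-left : ∀ {x y} → ((a , _) : OnLeft x) ((a′ , _) : OnLeft y) → dijoin D₁ D₂ x y ≡ D₁ a a′
  dijoin-left (a , ex) (a′ , ey) rewrite ex | ey = refl

  dijoin-right : ∀ {x y} → ((b , _) : OnRight x) ((b′ , _) : OnRight y) → dijoin D₁ D₂ x y ≡ D₂ b b′
  dijoin-right (b , ex) (b′ , ey) rewrite ex | ey = refl

  dijoin-no-back-arc : ∀ {x y} → OnRight x → OnLeft y → dijoin D₁ D₂ x y ≡ false
  dijoin-no-back-arc (b , ex) (a , ey) rewrite ex | ey = refl

  side : ∀ x → OnLeft x ⊎ OnRight x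
  side x with splitAt n₁ x
  ... | inj₁ a = inj₁ (a , refl)
  ... | inj₂ b = inj₂ (b , refl)

  OnRight-forward : ∀ {x y} → dijoin D₁ D₂ x y ≡ true → OnRight x → OnRight y
  OnRight-forward {y = y} arc right with side y
  ... | inj₂ right′ = right′
  ... | inj₁ left   = contradiction (trans (sym arc) (dijoin-no-back-arc right left)) λ ()

  OnLeft-backward : ∀ {x y} → dijoin D₁ D₂ x y ≡ true → OnLeft y → OnLeft x
  OnLeft-backward {x = x} arc left with side x
  ... | inj₁ left′ = left′
  ... | inj₂ right = contradiction (trans (sym arc) (dijoin-no-back-arc right left)) λ ()

  dijoin-acyclic : Acyclic D₁ → Acyclic D₂ → Acyclic (dijoin D₁ D₂)
  dijoin-acyclic acyclic₁ acyclic₂ (k , v , walk , closing) with side (v zero)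
  ... | inj₁ left  = acyclic₁ (restrict-cycle OnLeft proj₁ (λ p q arc → trans (sym (dijoin-left p q)) arc)
                   k v walk closing
                   (walk-backward OnLeft OnLeft-backward v walk (OnLeft-backward closing left)))
  ... | inj₂ right = acyclic₂ (restrict-cycle OnRight proj₁ (λ p q arc → trans (sym (dijoin-right p q)) arc)
                   k v walk closing
                   (walk-forward OnRight OnRight-forward v walk right))

dijoin-cong : ∀ {D₁ D₁′ : Digraph n₁} {D₂ D₂′ : Digraph n₂} →
  D₁ ≗₂ D₁′ → D₂ ≗₂ D₂′ → dijoin D₁ D₂ ≗₂ dijoin D₁′ D₂′
dijoin-cong {n₁} eq₁ eq₂ x y with splitAt n₁ x | splitAt n₁ y
... | inj₁ a | inj₁ a′ = eq₁ a a′
... | inj₁ a | inj₂ b  = refl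
... | inj₂ b | inj₁ a  = refl
... | inj₂ b | inj₂ b′ = eq₂ b b′

reverseWhere-dijoin : ∀ (D₁ : Digraph n₁) (D₂ : Digraph n₂) {N₁ N₂}
  (P : Fin n₁ ⊎ Fin n₂ → Fin n₁ ⊎ Fin n₂ → Bool) →
  (∀ a a′ → P (inj₁ a) (inj₁ a′) ≡ N₁ a a′) → (∀ a b → P (inj₁ a) (inj₂ b) ≡ false) →
  (∀ a b → P (inj₂ b) (inj₁ a) ≡ false) → (∀ b b′ → P (inj₂ b) (inj₂ b′) ≡ N₂ b b′) →
  reverseWhere (λ x y → P (splitAt n₁ x) (splitAt n₁ y)) (dijoin D₁ D₂)
    ≗₂ dijoin (reverseWhere N₁ D₁) (reverseWhere N₂ D₂)
reverseWhere-dijoin {n₁} D₁ D₂ P P₁₁ P₁₂ P₂₁ P₂₂ x y with splitAt n₁ x | splitAt n₁ y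
... | inj₁ a | inj₁ a′ rewrite P₁₁ a a′ = refl
... | inj₁ a | inj₂ b  rewrite P₁₂ a b  = refl
... | inj₂ b | inj₁ a  rewrite P₂₁ a b  = refl
... | inj₂ b | inj₂ b′ rewrite P₂₂ b b′ = refl

tournament-reverse : ∀ {D : Digraph n} → IsTournament D → ∀ {i j} → i ≢ j → D j i ≡ not (D i j)
tournament-reverse ((_ , asym) , total) {i} {j} i≢j with total i j i≢j
... | inj₁ ij = trans (asym i j ij) (cong not (sym ij))
... | inj₂ ji = trans ji (cong not (sym (asym j i ji)))

IsSymmetric : Matrix n → Set
IsSymmetric M = ∀ u w → M u w ≡ M w u

disagreement-symmetric : ∀ {D T : Digraph n} {M} → IsTournament D → IsTournament T →
  InM (GDT D T) M → IsSymmetric M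
disagreement-symmetric {D = D} {T} {M} tD tT M∈ u w with u ≟ w
... | yes refl = refl
... | no u≢w = begin
  M u w                       ≡⟨ M∈ u w u≢w ⟩
  D u w xor T u w             ≡⟨ sym (xor-annihilates-not (D u w) (T u w)) ⟩
  not (D u w) xor not (T u w) ≡⟨ sym (cong₂ _xor_ (tournament-reverse tD u≢w) (tournament-reverse tT u≢w)) ⟩
  D w u xor T w u             ≡⟨ sym (M∈ w u (u≢w ∘ sym)) ⟩
  M w u                       ∎
  where open ≡-Reasoning

reverse-disagreements : ∀ {D T : Digraph n} {M} → IsTournament D → IsTournament T →
  InM (GDT D T) M → reverseWhere M D ≗₂ T
reverse-disagreements {D = D} {T} {M} tD tT M∈ x y with x ≟ y
... | yes refl = trans (if-eta (M x x)) (trans (proj₁ (proj₁ tD) x) (sym (proj₁ (proj₁ tT) x)))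
... | no x≢y rewrite M∈ x y x≢y | tournament-reverse tD x≢y = flip-if (D x y) (T x y)
  where
  flip-if : ∀ d t → (if d xor t then not d else d) ≡ t
  flip-if false false = refl
  flip-if false true  = refl
  flip-if true  false = refl
  flip-if true  true  = refl

-- Spans and rank over F₂

infixl 6 _⊕_
infixr 7 _·_

_⊕_ : Subset n → Subset n → Subset n
(u ⊕ v) i = u i xor v i

_·_ : Bool → Subset n → Subset n
(c · v) i = c ∧ v i

InSpan : List (Subset n) → Subset n → Set
InSpan []      v = ∀ i → v i ≡ false
InSpan (w ∷ W) v = ∃[ c ] InSpan W (v ⊕ c · w)

InSpan-resp : ∀ W {v v′ : Subset n} → (∀ i → v i ≡ v′ i) → InSpan W v → InSpan W v′
InSpan-resp []      eq v∈ i       = trans (sym (eq i)) (v∈ i)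
InSpan-resp (w ∷ W) eq (c , v∈) = c , InSpan-resp W (λ i → cong (_xor (c ∧ w i)) (eq i)) v∈

InSpan-zero : ∀ (W : List (Subset n)) → InSpan W (const false)
InSpan-zero []      i = refl
InSpan-zero (w ∷ W)   = false , InSpan-zero W

InSpan-⊕· : ∀ W {v u : Subset n} α → InSpan W v → InSpan W u → InSpan W (v ⊕ α · u)
InSpan-⊕· []      α v∈ u∈ i rewrite v∈ i | u∈ i = ∧-zeroʳ α
InSpan-⊕· (w ∷ W) {v} {u} α (c , v∈) (d , u∈) =
  c xor (α ∧ d) , InSpan-resp W (λ i → regroup (v i) c (w i) α (u i) d) (InSpan-⊕· W α v∈ u∈)
  where
  regroup : ∀ v c w α u d →
    (v xor (c ∧ w)) xor (α ∧ (u xor (d ∧ w))) ≡ (v xor (α ∧ u)) xor ((c xor (α ∧ d)) ∧ w)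
  regroup = solve-∀ F₂

InSpan? : ∀ W (v : Subset n) → Dec (InSpan W v)
InSpan? []      v = all? (λ i → v i Boolₚ.≟ false)
InSpan? (w ∷ W) v with InSpan? W (v ⊕ false · w) | InSpan? W (v ⊕ true · w)
... | yes v∈ | _      = yes (false , v∈)
... | no _   | yes v∈ = yes (true , v∈)
... | no v∉  | no v∉′ = no λ { (false , v∈) → v∉ v∈ ; (true , v∈) → v∉′ v∈ }

-- Clears the j-th coordinate of w′ provided w j ≡ true.
clear : Fin n → Subset n → Subset n → Subset n
clear j w w′ = w′ ⊕ w′ j · w

InSpan-clear : ∀ j w W {z : Subset n} → InSpan W z → InSpan (map (clear j w) W) (clear j w z)
InSpan-clear j w []        z∈ t rewrite z∈ t | z∈ j = refl
InSpan-clear j w (w′ ∷ W) {z} (d , z∈) =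
  d , InSpan-resp (map (clear j w) W) (λ t → regroup (z t) (z j) (w t) d (w′ t) (w′ j)) (InSpan-clear j w W z∈)
  where
  regroup : ∀ zt zj wt d w′t w′j →
    (zt xor (d ∧ w′t)) xor ((zj xor (d ∧ w′j)) ∧ wt) ≡ (zt xor (zj ∧ wt)) xor (d ∧ (w′t xor (w′j ∧ wt)))
  regroup = solve-∀ F₂

-- Gaussian elimination: the first spanning vector with a nonzero j-th coordinate is the pivot.
span-pivot : ∀ W j {u : Subset n} → InSpan W u → u j ≡ true →
  ∃[ W′ ] length W ≡ suc (length W′) × (∀ {v} → InSpan W v → v j ≡ false → InSpan W′ v)
span-pivot []      j u∈ uj = contradiction (trans (sym uj) (u∈ j)) λ ()
span-pivot (w ∷ W) j {u} (c , u∈) uj with w j in wj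
... | true = map (clear j w) W , cong suc (sym (length-map _ W)) , restrict
  where
  restrict : ∀ {v} → InSpan (w ∷ W) v → v j ≡ false → InSpan (map (clear j w) W) v
  restrict {v} (d , v∈) vj = InSpan-resp _ cleared (InSpan-clear j w W v∈)
    where
    cancel : ∀ vt d wt → (vt xor (d ∧ wt)) xor ((false xor (d ∧ true)) ∧ wt) ≡ vt
    cancel = solve-∀ F₂
    cleared : ∀ t → clear j w (v ⊕ d · w) t ≡ v t
    cleared t rewrite vj | wj = cancel (v t) d (w t)
... | false with span-pivot W j u∈ (trans (cong₂ (λ a b → a xor (c ∧ b)) uj wj) (cong not (∧-zeroʳ c)))
...   | W′ , |W|≡ , restrict =
  w ∷ W′ , cong suc |W|≡ ,
  λ { (d , v∈) vj → d , restrict v∈ (trans (cong₂ (λ a b → a xor (d ∧ b)) vj wj) (∧-zeroʳ d)) }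

rowsOf : (Fin m → Subset n) → (Fin m → Bool) → List (Subset n)
rowsOf {zero}  R S = []
rowsOf {suc m} R S = if S zero then R zero ∷ rowsOf (R ∘ suc) (S ∘ suc) else rowsOf (R ∘ suc) (S ∘ suc)

length-rowsOf : ∀ (R : Fin m → Subset n) S → length (rowsOf R S) ≡ count S
length-rowsOf {zero}  R S = refl
length-rowsOf {suc m} R S with S zero
... | true  = cong suc (length-rowsOf (R ∘ suc) (S ∘ suc))
... | false = length-rowsOf (R ∘ suc) (S ∘ suc)

InSpan-rowsOf : ∀ (R : Fin m → Subset n) S {u} → S u ≡ true → InSpan (rowsOf R S) (R u)
InSpan-rowsOf {suc m} R S {zero} Su with S zero
... | true  = true , InSpan-resp _ (λ j → sym (xor-same (R zero j))) (InSpan-zero _)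
InSpan-rowsOf {suc m} R S {suc u} Su with S zero
... | true  = false , InSpan-resp _ (λ j → sym (xor-identityʳ (R (suc u) j))) (InSpan-rowsOf (R ∘ suc) (S ∘ suc) Su)
... | false = InSpan-rowsOf (R ∘ suc) (S ∘ suc) Su

InSpan-sumRows : ∀ (R : Fin m → Subset n) S T → (∀ i → T i ≡ true → S i ≡ true) →
  InSpan (rowsOf R S) (sumRows R T)
InSpan-sumRows {zero}  R S T T⊆S j = refl
InSpan-sumRows {suc m} R S T T⊆S with S zero in S₀ | T zero in T₀
... | true  | true  = true , InSpan-resp _ (λ j → cancel (R zero j) _) rest
  where
  cancel : ∀ r s → s ≡ (r xor s) xor r
  cancel = solve-∀ F₂
  rest = InSpan-sumRows (R ∘ suc) (S ∘ suc) (T ∘ suc) (T⊆S ∘ suc)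
... | true  | false = false , InSpan-resp _ (λ j → sym (xor-identityʳ _))
                               (InSpan-sumRows (R ∘ suc) (S ∘ suc) (T ∘ suc) (T⊆S ∘ suc))
... | false | true  = contradiction (trans (sym (T⊆S zero T₀)) S₀) λ ()
... | false | false = InSpan-sumRows (R ∘ suc) (S ∘ suc) (T ∘ suc) (T⊆S ∘ suc)

sumRows-remove : ∀ (R : Fin m → Fin n → Bool) T u j →
  sumRows R T j ≡ sumRows R (updateAt T u (const false)) j xor (if T u then R u j else false)
sumRows-remove {suc m} R T zero    j =
  xor-comm (if T zero then R zero j else false) (sumRows (R ∘ suc) (T ∘ suc) j)
sumRows-remove {suc m} R T (suc u) j =
  trans (cong (first xor_) (sumRows-remove (R ∘ suc) (T ∘ suc) u j))
        (sym (xor-assoc first (sumRows (R ∘ suc) (updateAt (T ∘ suc) u (const false)) j) _))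
  where first = if T zero then R zero j else false

count-insert : ∀ (S : Fin m → Bool) u → S u ≡ false → count (updateAt S u (const true)) ≡ suc (count S)
count-insert {suc m} S zero    Su rewrite Su = refl
count-insert {suc m} S (suc u) Su =
  trans (cong ((if S zero then 1 else 0) +_) (count-insert (S ∘ suc) u Su)) (+-suc _ _)

module _ {M : Matrix n} {S : Fin n → Bool} where

  independent-insert : RowsIndependent M S → ∀ {u} → ¬ InSpan (rowsOf M S) (M u) →
    RowsIndependent M (updateAt S u (const true))
  independent-insert independent {u} Mu∉ T T⊆S′ nonempty sum≡0 with T u in Tu
  ... | false = independent T T⊆S nonempty sum≡0
    where
    T⊆S : ∀ i → T i ≡ true → S i ≡ true
    T⊆S i Ti with i ≟ u
    ... | yes refl = contradiction (trans (sym Ti) Tu) λ ()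
    ... | no i≢u   = trans (sym (updateAt-minimal i u S i≢u)) (T⊆S′ i Ti)
  ... | true = Mu∉ (InSpan-resp _ Mu≡ (InSpan-sumRows M S T′ T′⊆S))
    where
    T′ = updateAt T u (const false)
    T′⊆S : ∀ i → T′ i ≡ true → S i ≡ true
    T′⊆S i T′i with i ≟ u
    ... | yes refl = contradiction (trans (sym T′i) (updateAt-updates u T)) λ ()
    ... | no i≢u   = trans (sym (updateAt-minimal i u S i≢u))
                           (T⊆S′ i (trans (sym (updateAt-minimal i u T i≢u)) T′i))
    solve-for : ∀ s r → false ≡ s xor r → s ≡ r
    solve-for false false _ = refl
    solve-for true  true  _ = refl
    Mu≡ : ∀ j → sumRows M T′ j ≡ M u j
    Mu≡ j = solve-for _ _ (trans (sym (sum≡0 j)) (trans (sumRows-remove M T u j)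
                                 (cong (λ b → sumRows M T′ j xor (if b then M u j else false)) Tu)))

  maximal-independent-spans : RowsIndependent M S → (∀ S′ → RowsIndependent M S′ → count S′ ≤ count S) →
    ∀ u → InSpan (rowsOf M S) (M u)
  maximal-independent-spans independent maximal u with InSpan? (rowsOf M S) (M u) | S u in Su
  ... | yes Mu∈ | _     = Mu∈
  ... | no Mu∉  | true  = contradiction (InSpan-rowsOf M S Su) Mu∉
  ... | no Mu∉  | false = contradiction
    (subst (_≤ count S) (count-insert S u Su) (maximal _ (independent-insert independent Mu∉))) 1+n≰n

rank-spanning : ∀ {M : Matrix n} {t} → HasRank M t → ∃[ W ] length W ≤ t × (∀ u → InSpan W (M u))
rank-spanning {M = M} ((S , independent , |S|≡t) , maximal) =
  rowsOf M S , ≤-reflexive (trans (length-rowsOf M S) |S|≡t) ,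
  maximal-independent-spans independent (λ S′ ind′ → subst (count S′ ≤_) (sym |S|≡t) (maximal S′ ind′))

-- Gram factorisations of symmetric matrices

-- L = [(x₁, f₁), …] realises M when the vectors (xᵢ, fᵢ) ∈ F₂ⁿ⁺¹ have Gram matrix M ⊕ (1).
gram : List (Subset n × Bool) → Matrix n
gram L u w = xorSum L (λ (x , f) → x u ∧ x w)

cross : List (Subset n × Bool) → Subset n
cross L u = xorSum L (λ (x , f) → f ∧ x u)

norm : List (Subset n × Bool) → Bool
norm L = xorSum L (λ (x , f) → f ∧ f)

record Realises (M : Matrix n) (L : List (Subset n × Bool)) : Set where
  field
    gram≡  : gram L ≗₂ M
    cross≡ : ∀ u → cross L u ≡ false
    norm≡  : norm L ≡ true

twist : Subset n → Subset n × Bool → Subset n × Bool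
twist b (x , f) = x ⊕ f · b , f

module _ (b : Subset n) where

  gram-twist : ∀ L u w → gram (map (twist b) L) u w ≡
    (gram L u w xor (b w ∧ cross L u)) xor ((b u ∧ cross L w) xor ((b u ∧ b w) ∧ norm L))
  gram-twist []            u w = expand (b u) (b w)
    where
    expand : ∀ bu bw → false ≡ (false xor (bw ∧ false)) xor ((bu ∧ false) xor ((bu ∧ bw) ∧ false))
    expand = solve-∀ F₂
  gram-twist ((x , f) ∷ L) u w =
    trans (cong (((x u xor (f ∧ b u)) ∧ (x w xor (f ∧ b w))) xor_) (gram-twist L u w))
          (expand (x u) (x w) (b u) (b w) f (gram L u w) (cross L u) (cross L w) (norm L))
    where
    expand : ∀ xu xw bu bw f g cu cw r →
      ((xu xor (f ∧ bu)) ∧ (xw xor (f ∧ bw))) xor ((g xor (bw ∧ cu)) xor ((bu ∧ cw) xor ((bu ∧ bw) ∧ r)))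
      ≡ (((xu ∧ xw) xor g) xor (bw ∧ ((f ∧ xu) xor cu)))
          xor ((bu ∧ ((f ∧ xw) xor cw)) xor ((bu ∧ bw) ∧ ((f ∧ f) xor r)))
    expand = solve-∀ F₂

  cross-twist : ∀ L u → cross (map (twist b) L) u ≡ cross L u xor (b u ∧ norm L)
  cross-twist []            u = sym (∧-zeroʳ (b u))
  cross-twist ((x , f) ∷ L) u =
    trans (cong ((f ∧ (x u xor (f ∧ b u))) xor_) (cross-twist L u)) (expand f (x u) (b u) (cross L u) (norm L))
    where
    expand : ∀ f xu bu c r →
      (f ∧ (xu xor (f ∧ bu))) xor (c xor (bu ∧ r)) ≡ ((f ∧ xu) xor c) xor (bu ∧ ((f ∧ f) xor r))
    expand = solve-∀ F₂

  norm-twist : ∀ L → norm (map (twist b) L) ≡ norm L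
  norm-twist []            = refl
  norm-twist ((x , f) ∷ L) = cong ((f ∧ f) xor_) (norm-twist L)

realises-zero : ∀ {M : Matrix n} → (∀ u w → M u w ≡ false) → Realises M ((const false , true) ∷ [])
realises-zero M≡0 = record { gram≡ = λ u w → sym (M≡0 u w) ; cross≡ = λ u → refl ; norm≡ = refl }

realises-square : ∀ {M M′ : Matrix n} {L} x → Realises M′ L →
  (∀ u w → M u w ≡ (x u ∧ x w) xor M′ u w) → Realises M ((x , false) ∷ L)
realises-square x R M≡ = record
  { gram≡  = λ u w → trans (cong ((x u ∧ x w) xor_) (gram≡ u w)) (sym (M≡ u w))
  ; cross≡ = cross≡
  ; norm≡  = norm≡
  }
  where open Realises R

realises-hyperbolic : ∀ {M M′ : Matrix n} {L} x y → Realises M′ L →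
  (∀ u w → M u w ≡ (M′ u w xor (x u ∧ y w)) xor (y u ∧ x w)) →
  Realises M ((y , true) ∷ (x ⊕ y , true) ∷ map (twist x) L)
realises-hyperbolic {M = M} {M′} {L} x y R M≡ = record
  { gram≡  = λ u w → trans (gram-hyperbolic u w) (sym (M≡ u w))
  ; cross≡ = cross-hyperbolic
  ; norm≡  = trans (cong (λ r → true xor (true xor r)) (norm-twist x L)) (cong (λ r → not (not r)) norm≡)
  }
  where
  open Realises R
  gram-hyperbolic : ∀ u w → gram ((y , true) ∷ (x ⊕ y , true) ∷ map (twist x) L) u w
                          ≡ (M′ u w xor (x u ∧ y w)) xor (y u ∧ x w)
  gram-hyperbolic u w rewrite gram-twist x L u w | gram≡ u w | cross≡ u | cross≡ w | norm≡ =
    expand (x u) (x w) (y u) (y w) (M′ u w)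
    where
    expand : ∀ xu xw yu yw m →
      (yu ∧ yw) xor (((xu xor yu) ∧ (xw xor yw))
                      xor ((m xor (xw ∧ false)) xor ((xu ∧ false) xor ((xu ∧ xw) ∧ true))))
      ≡ (m xor (xu ∧ yw)) xor (yu ∧ xw)
    expand = solve-∀ F₂
  cross-hyperbolic : ∀ u → cross ((y , true) ∷ (x ⊕ y , true) ∷ map (twist x) L) u ≡ false
  cross-hyperbolic u rewrite cross-twist x L u | cross≡ u | norm≡ = expand (x u) (y u)
    where
    expand : ∀ xu yu → yu xor ((xu xor yu) xor (false xor (xu ∧ true))) ≡ false
    expand = solve-∀ F₂

data Pivot (M : Matrix n) : Set where
  no-pivot         : (∀ u w → M u w ≡ false) → Pivot M
  diagonal-pivot   : ∀ j → M j j ≡ true → Pivot M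
  hyperbolic-pivot : ∀ j l → M j l ≡ true → (∀ i → M i i ≡ false) → Pivot M

pivot : ∀ (M : Matrix n) → Pivot M
pivot M with any? (λ j → M j j Boolₚ.≟ true)
... | yes (j , Mjj) = diagonal-pivot j Mjj
... | no no-diagonal with any? (λ j → any? (λ l → M j l Boolₚ.≟ true))
...   | yes (j , l , Mjl) = hyperbolic-pivot j l Mjl (λ i → ¬-not λ Mii → no-diagonal (i , Mii))
...   | no all-zero       = no-pivot (λ u w → ¬-not λ Muw → all-zero (u , w , Muw))

-- For symmetric M: deflate j M = M − x xᵀ and deflate₂ j l M = M − (x yᵀ + y xᵀ), x = M j, y = M l.
deflate : Fin n → Matrix n → Matrix n
deflate j M u w = M u w xor (M u j ∧ M j w)

deflate₂ : Fin n → Fin n → Matrix n → Matrix n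
deflate₂ j l M u w = (M u w xor (M u j ∧ M l w)) xor (M u l ∧ M j w)

module _ {M : Matrix n} (symmetric : IsSymmetric M) where

  deflate-symmetric : ∀ j → IsSymmetric (deflate j M)
  deflate-symmetric j u w rewrite symmetric u w | symmetric u j | symmetric w j =
    cong (M w u xor_) (∧-comm (M j u) (M j w))

  deflate-square : ∀ j u w → M u w ≡ (M j u ∧ M j w) xor deflate j M u w
  deflate-square j u w rewrite symmetric u j = cancel (M j u ∧ M j w) (M u w)
    where
    cancel : ∀ a m → m ≡ a xor (m xor a)
    cancel = solve-∀ F₂

  deflate-rows : ∀ {W j} → (∀ u → InSpan W (M u)) → M j j ≡ true →
    ∃[ W′ ] length W ≡ suc (length W′) × (∀ u → InSpan W′ (deflate j M u))
  deflate-rows {W} {j} rows Mjj with span-pivot W j (rows j) Mjj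
  ... | W′ , |W|≡ , restrict =
    W′ , |W|≡ , λ u → restrict (InSpan-⊕· W (M u j) (rows u) (rows j)) (vanish u)
    where
    vanish : ∀ u → M u j xor (M u j ∧ M j j) ≡ false
    vanish u rewrite Mjj | ∧-identityʳ (M u j) = xor-same (M u j)

  deflate₂-symmetric : ∀ j l → IsSymmetric (deflate₂ j l M)
  deflate₂-symmetric j l u w
    rewrite symmetric w u | symmetric w j | symmetric l u | symmetric w l | symmetric j u =
    regroup (M u w) (M u j) (M l w) (M u l) (M j w)
    where
    regroup : ∀ m a b c d → (m xor (a ∧ b)) xor (c ∧ d) ≡ (m xor (d ∧ c)) xor (b ∧ a)
    regroup = solve-∀ F₂

  deflate₂-hyperbolic : ∀ j l u w → M u w ≡ (deflate₂ j l M u w xor (M j u ∧ M l w)) xor (M l u ∧ M j w)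
  deflate₂-hyperbolic j l u w rewrite symmetric j u | symmetric l u =
    cancel (M u w) (M u j ∧ M l w) (M u l ∧ M j w)
    where
    cancel : ∀ m a b → m ≡ (((m xor a) xor b) xor a) xor b
    cancel = solve-∀ F₂

  deflate₂-rows : ∀ {W j l} → (∀ u → InSpan W (M u)) → M j l ≡ true → (∀ i → M i i ≡ false) →
    ∃[ W″ ] length W ≡ suc (suc (length W″)) × (∀ u → InSpan W″ (deflate₂ j l M u))
  deflate₂-rows {W} {j} {l} rows Mjl diagonal
    with span-pivot W j (rows l) (trans (symmetric l j) Mjl)
  ... | W′ , |W|≡ , restrict
    with span-pivot W′ l (restrict (rows j) (diagonal j)) Mjl
  ...   | W″ , |W′|≡ , restrict′ =
    W″ , trans |W|≡ (cong suc |W′|≡) ,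
    λ u → restrict′ (restrict (InSpan-⊕· W (M u l) (InSpan-⊕· W (M u j) (rows u) (rows l)) (rows j)) (vanish-j u))
                    (vanish-l u)
    where
    vanish-j : ∀ u → deflate₂ j l M u j ≡ false
    vanish-j u rewrite symmetric l j | Mjl | diagonal j = cancel (M u j) (M u l)
      where
      cancel : ∀ a b → (a xor (a ∧ true)) xor (b ∧ false) ≡ false
      cancel = solve-∀ F₂
    vanish-l : ∀ u → deflate₂ j l M u l ≡ false
    vanish-l u rewrite Mjl | diagonal l = cancel (M u l) (M u j)
      where
      cancel : ∀ a b → (a xor (b ∧ false)) xor (a ∧ true) ≡ false
      cancel = solve-∀ F₂

Factorisable : ℕ → ℕ → Set
Factorisable n k = ∀ (M : Matrix n) W → length W ≤ k → IsSymmetric M → (∀ u → InSpan W (M u)) →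
  ∃[ L ] length L ≤ suc k × Realises M L

-- Induction on the dimension of a space containing the rows: each pivot lowers it.
factorisation : ∀ k → Factorisable n k
factorisation {n} = <-rec (Factorisable n) step
  where
  step : ∀ k → (∀ {k′} → k′ < k → Factorisable n k′) → Factorisable n k
  step k rec M W |W|≤k symmetric rows with pivot M
  ... | no-pivot M≡0 = _ , s≤s z≤n , realises-zero M≡0
  ... | diagonal-pivot j Mjj =
    let W′ , |W|≡ , rows′ = deflate-rows symmetric rows Mjj
        |W′|<k = subst (_≤ k) |W|≡ |W|≤k
        L , |L|≤ , R = rec |W′|<k (deflate j M) W′ ≤-refl (deflate-symmetric symmetric j) rows′
    in (M j , false) ∷ L , s≤s (≤-trans |L|≤ |W′|<k) , realises-square (M j) R (deflate-square symmetric j)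
  ... | hyperbolic-pivot j l Mjl diagonal =
    let W″ , |W|≡ , rows″ = deflate₂-rows symmetric rows Mjl diagonal
        |W″|+1<k = subst (_≤ k) |W|≡ |W|≤k
        L , |L|≤ , R = rec (<⇒≤ |W″|+1<k) (deflate₂ j l M) W″ ≤-refl
                           (deflate₂-symmetric symmetric j l) rows″
    in (M l , true) ∷ (M j ⊕ M l , true) ∷ map (twist (M j)) L ,
       s≤s (subst (λ m → suc m ≤ k) (sym (length-map (twist (M j)) L)) (≤-trans (s≤s |L|≤) |W″|+1<k)) ,
       realises-hyperbolic (M j) (M l) R (deflate₂-hyperbolic symmetric j l)

-- Inverting a dijoin

module _ (L : List (Subset n₁ × Bool)) (Y₁ : Subset n₂) (Ys : List (Subset n₂)) where

  leftSet : Subset n₁ × Bool → Fin n₁ ⊎ Fin n₂ → Bool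
  leftSet (x , f) = [ x , f · Y₁ ]′

  rightSet : Subset n₂ → Fin n₁ ⊎ Fin n₂ → Bool
  rightSet Y = [ const false , Y ]′

  blocks : List (Fin n₁ ⊎ Fin n₂ → Bool)
  blocks = map leftSet L ++ map rightSet Ys

  dijoinFamily : List (Subset (n₁ + n₂))
  dijoinFamily = map (_∘ splitAt n₁) blocks

  length-dijoinFamily : length dijoinFamily ≡ length L + length Ys
  length-dijoinFamily = begin
    length dijoinFamily                               ≡⟨ length-map (_∘ splitAt n₁) blocks ⟩
    length blocks                                     ≡⟨ length-++ (map leftSet L) ⟩
    length (map leftSet L) + length (map rightSet Ys) ≡⟨ cong₂ _+_ (length-map leftSet L) (length-map rightSet Ys) ⟩
    length L + length Ys                              ∎
    where open ≡-Reasoning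

  parity-blocks : ∀ s t → parity blocks s t ≡
    xorSum L (λ p → leftSet p s ∧ leftSet p t) xor xorSum Ys (λ Y → rightSet Y s ∧ rightSet Y t)
  parity-blocks s t = trans (xorSum-++ (map leftSet L) (map rightSet Ys) _)
                            (cong₂ _xor_ (xorSum-map leftSet L _) (xorSum-map rightSet Ys _))

  module _ {M : Matrix n₁} (R : Realises M L) where
    open Realises R

    parity₁₁ : ∀ a a′ → parity blocks (inj₁ a) (inj₁ a′) ≡ M a a′
    parity₁₁ a a′ =
      trans (parity-blocks _ _) (trans (cong₂ _xor_ (gram≡ a a′) (xorSum-false Ys)) (xor-identityʳ _))

    parity₁₂ : ∀ a b → parity blocks (inj₁ a) (inj₂ b) ≡ false
    parity₁₂ a b = begin
      parity blocks (inj₁ a) (inj₂ b)                         ≡⟨ parity-blocks _ _ ⟩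
      xorSum L (λ (x , f) → x a ∧ (f ∧ Y₁ b)) xor xorSum Ys (const false)
        ≡⟨ cong₂ _xor_ (xorSum-cong L (λ (x , f) → regroup (x a) f (Y₁ b))) (xorSum-false Ys) ⟩
      xorSum L (λ (x , f) → Y₁ b ∧ (f ∧ x a)) xor false       ≡⟨ xor-identityʳ _ ⟩
      xorSum L (λ (x , f) → Y₁ b ∧ (f ∧ x a))                 ≡⟨ xorSum-∧ L (Y₁ b) _ ⟩
      Y₁ b ∧ cross L a                                        ≡⟨ cong (Y₁ b ∧_) (cross≡ a) ⟩
      Y₁ b ∧ false                                            ≡⟨ ∧-zeroʳ (Y₁ b) ⟩
      false                                                   ∎
      where
      open ≡-Reasoning
      regroup : ∀ xa f y → xa ∧ (f ∧ y) ≡ y ∧ (f ∧ xa)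
      regroup = solve-∀ F₂

    parity₂₁ : ∀ a b → parity blocks (inj₂ b) (inj₁ a) ≡ false
    parity₂₁ a b = trans (parity-comm blocks _ _) (parity₁₂ a b)

    parity₂₂ : ∀ b b′ → parity blocks (inj₂ b) (inj₂ b′) ≡ parity (Y₁ ∷ Ys) b b′
    parity₂₂ b b′ = begin
      parity blocks (inj₂ b) (inj₂ b′)
        ≡⟨ parity-blocks _ _ ⟩
      xorSum L (λ (x , f) → (f ∧ Y₁ b) ∧ (f ∧ Y₁ b′)) xor parity Ys b b′
        ≡⟨ cong (_xor parity Ys b b′) (xorSum-cong L (λ (x , f) → regroup f (Y₁ b) (Y₁ b′))) ⟩
      xorSum L (λ (x , f) → (Y₁ b ∧ Y₁ b′) ∧ (f ∧ f)) xor parity Ys b b′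
        ≡⟨ cong (_xor parity Ys b b′) (xorSum-∧ L (Y₁ b ∧ Y₁ b′) _) ⟩
      ((Y₁ b ∧ Y₁ b′) ∧ norm L) xor parity Ys b b′
        ≡⟨ cong (λ r → ((Y₁ b ∧ Y₁ b′) ∧ r) xor parity Ys b b′) norm≡ ⟩
      ((Y₁ b ∧ Y₁ b′) ∧ true) xor parity Ys b b′
        ≡⟨ cong (_xor parity Ys b b′) (∧-identityʳ (Y₁ b ∧ Y₁ b′)) ⟩
      parity (Y₁ ∷ Ys) b b′
        ∎
      where
      open ≡-Reasoning
      regroup : ∀ f y y′ → (f ∧ y) ∧ (f ∧ y′) ≡ (y ∧ y′) ∧ (f ∧ f)
      regroup = solve-∀ F₂

    dijoin-inversion : ∀ {D₁ T : Digraph n₁} {D₂ : Digraph n₂} →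
      IsTournament D₁ → IsTransitiveTournament T → InM (GDT D₁ T) M →
      Acyclic (invertAll (Y₁ ∷ Ys) D₂) → Acyclic (invertAll dijoinFamily (dijoin D₁ D₂))
    dijoin-inversion {D₁} {T} {D₂} tournament (transitive , acyclic) M∈ acyclic₂ =
      Acyclic-resp (λ x y → sym (inverted x y)) (dijoin-acyclic acyclic acyclic₂)
      where
      open ≡-Reasoning
      inverted : invertAll dijoinFamily (dijoin D₁ D₂) ≗₂ dijoin T (invertAll (Y₁ ∷ Ys) D₂)
      inverted x y = begin
        invertAll dijoinFamily (dijoin D₁ D₂) x y
          ≡⟨ invertAll-parity dijoinFamily _ x y ⟩
        reverseWhere (parity dijoinFamily) (dijoin D₁ D₂) x y
          ≡⟨ reverseWhere-cong (dijoin D₁ D₂) (parity-∘ (splitAt n₁) blocks) x y ⟩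
        reverseWhere (λ x y → parity blocks (splitAt n₁ x) (splitAt n₁ y)) (dijoin D₁ D₂) x y
          ≡⟨ reverseWhere-dijoin D₁ D₂ (parity blocks) parity₁₁ parity₁₂ parity₂₁ parity₂₂ x y ⟩
        dijoin (reverseWhere M D₁) (reverseWhere (parity (Y₁ ∷ Ys)) D₂) x y
          ≡⟨ dijoin-cong (reverse-disagreements tournament transitive M∈)
                         (λ b b′ → sym (invertAll-parity (Y₁ ∷ Ys) D₂ b b′)) x y ⟩
        dijoin T (invertAll (Y₁ ∷ Ys) D₂) x y
          ∎

InvAtMost-suc : ∀ {D : Digraph n} {k} → InvAtMost D (suc k) →
  ∃₂ λ Y Ys → length Ys ≤ k × Acyclic (invertAll (Y ∷ Ys) D)
InvAtMost-suc ([]       , _          , acyclic) = const false , [] , z≤n , acyclic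
InvAtMost-suc ((Y ∷ Ys) , s≤s |Ys|≤k , acyclic) = Y , Ys , |Ys|≤k , acyclic

dijoin-InvAtMost : ∀ {D₁ : Digraph n₁} {D₂ : Digraph n₂} {M t k} →
  IsTournament D₁ → InMStar D₁ M → HasRank M t → InvAtMost D₂ (suc k) →
  InvAtMost (dijoin D₁ D₂) (suc t + k)
dijoin-InvAtMost {M = M} {t} tournament (T , transitive , M∈) rank inv₂ =
  let W , |W|≤t , rows = rank-spanning rank
      L , |L|≤ , R = factorisation t M W |W|≤t (disagreement-symmetric tournament (proj₁ transitive) M∈) rows
      Y₁ , Ys , |Ys|≤k , acyclic₂ = InvAtMost-suc inv₂
  in dijoinFamily L Y₁ Ys ,
     subst (_≤ suc t + _) (sym (length-dijoinFamily L Y₁ Ys)) (+-mono-≤ |L|≤ |Ys|≤k) ,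
     dijoin-inversion L Y₁ Ys R tournament transitive M∈ acyclic₂

-- inv(D₁) enters only through i₁ = t₁ + 1, and D₂ need not be oriented.
lemma3p3 : ∀ {n₁ n₂} (D₁ : Digraph n₁) (D₂ : Digraph n₂) (i₁ t₁ i₂ : ℕ) →
    IsTournament D₁ → IsInv D₁ i₁ → IsTmr D₁ t₁ → i₁ ≡ t₁ + 1 →
    IsOriented D₂ → IsInv D₂ i₂ → 1 ≤ i₂ →
    InvAtMost (dijoin D₁ D₂) (i₁ + i₂ ∸ 1)
lemma3p3 D₁ D₂ .(t₁ + 1) t₁ (suc i₂) tournament _ ((M , M∈ , rank) , _) refl _ (inv₂ , _) (s≤s z≤n) =
  subst (InvAtMost (dijoin D₁ D₂)) (sym bound) (dijoin-InvAtMost tournament M∈ rank inv₂)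
  where
  open ≡-Reasoning
  bound : t₁ + 1 + suc i₂ ∸ 1 ≡ suc t₁ + i₂
  bound = begin
    t₁ + 1 + suc i₂ ∸ 1 ≡⟨ cong (_∸ 1) (+-suc (t₁ + 1) i₂) ⟩
    t₁ + 1 + i₂         ≡⟨ cong (_+ i₂) (+-comm t₁ 1) ⟩
    suc t₁ + i₂         ∎
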